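{- In the setting of the context, the procedure $\mathcal{H}_m(\mathcal{M},\forall\vec x\,\varphi)$ terminates, and the set $\Theta$ it returns is empty if and only if $\mathcal{M}\models\forall\vec x\,\varphi$.
   Context: $\mathcal{M}$ is an interpretation and $\varphi$ a quantifier-free formula with free variables among $\vec x=(x_1,\dots,x_n)$, $x_i$ of sort $S_i$, where each $S_i$ is interpreted in $\mathcal{M}$ as a finite nonempty set $\mathbf V_{S_i}$ of elements, each named by a term. Let $\mathbf V_{\vec x}=\mathbf V_{S_1}\times\dots\times\mathbf V_{S_n}$, fix a total order $<_{S}$ on each $\mathbf V_S$, and let $<$ be the lexicographic order on $\mathbf V_{\vec x}$ (position 1 most significant); $\vec v_{min}$ is its minimum. For $\vec v\in\mathbf V_{\vec x}$ and integer $i\ge1$, $\mathrm{next}_i(\vec v)$ is the smallest (w.r.t. $<$) tuple $\vec u$ with $\vec v<\vec u$ and $\vec u(j)\ne\vec v(j)$ for some $1\le j\le n+1-i$, if one exists, and $\vec v_{min}$ otherwise (in particular whenever $i>n$). The procedure $\mathsf{eval}(\mathcal{M},\varphi,\sigma)$, for a substitution $\sigma$ mapping $\vec x$ to $\mathbf V_{\vec x}$, returns a pair $(v,X)$ where $v\in\{\mathsf{true},\mathsf{false}\}$ is the truth value of $\varphi\sigma$ in $\mathcal{M}$ and $X\subseteq\{x_1,\dots,x_n\}$ (the critical variables) is such that $\varphi\sigma'$ has the same truth value $v$ in $\mathcal M$ for every substitution $\sigma'$ into $\mathbf V_{\vec x}$ agreeing with $\sigma$ on $X$. Procedure $\mathcal{H}_m(\mathcal{M},\forall\vec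 x\,\varphi)$: set $\Theta:=\emptyset$, $t:=\vec v_{min}$; repeat: let $(v,\{x_{i_1},\dots,x_{i_p}\}):=\mathsf{eval}(\mathcal M,\varphi,\{\vec x\mapsto t\})$; if $v=\mathsf{false}$ add $\{\vec x\mapsto t\}$ to $\Theta$; set $t:=\mathrm{next}_i(t)$ with $i=n+1-\max\{0,i_1,\dots,i_p\}$; until $t=\vec v_{min}$; return $\Theta$. Here $\mathcal{M}\models\forall\vec x\,\varphi$ means $\varphi$ holds for all assignments of $\vec x$ to $\mathbf V_{\vec x}$. -}

module Defs where

open import Data.Nat using (ℕ; zero; suc; _∸_; _⊔_; _<ᵇ_; _≡ᵇ_)
open import Data.Fin using (Fin; toℕ)
open import Data.Fin.Subset using (Subset)
open import Data.Bool using (Bool; true; false; _∧_; _∨_; not; if_then_else_)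
open import Data.Vec using (Vec; []; _∷_; lookup)
open import Data.List as L using (List; allFin; concatMap; filterᵇ)
open import Data.Maybe using (Maybe; just; nothing)
open import Data.Product using (_×_; _,_; proj₁; proj₂)
open import Relation.Binary.PropositionalEquality using (_≡_)

-- Sorts S_1..S_n: the i-th variable ranges over a finite nonempty set
-- V_{S_i} = Fin (suc (ks i)), totally ordered by the natural order of Fin.
-- Tuples in V_x = V_{S_1} × ... × V_{S_n} (position 1 = head):
data Tup : ∀ {n} → Vec ℕ n → Set where
  []  : Tup []
  _∷_ : ∀ {n k} {ks : Vec ℕ n} → Fin (suc k) → Tup ks → Tup (k ∷ ks)

-- component i of a tuple (i : Fin n, 0-based, i.e. variable x_{i+1})
at : ∀ {n} {ks : Vec ℕ n} → Tup ks → (i : Fin n) → Fin (suc (lookup ks i))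
at (a ∷ t) Fin.zero    = a
at (a ∷ t) (Fin.suc i) = at t i

eqᵇ : ∀ {n} {ks : Vec ℕ n} → Tup ks → Tup ks → Bool
eqᵇ [] [] = true
eqᵇ (a ∷ u) (b ∷ w) = (toℕ a ≡ᵇ toℕ b) ∧ eqᵇ u w

lexᵇ : ∀ {n} {ks : Vec ℕ n} → Tup ks → Tup ks → Bool
lexᵇ [] [] = false
lexᵇ (a ∷ u) (b ∷ w) = (toℕ a <ᵇ toℕ b) ∨ ((toℕ a ≡ᵇ toℕ b) ∧ lexᵇ u w)

vmin : ∀ {n} (ks : Vec ℕ n) → Tup ks
vmin [] = []
vmin (k ∷ ks) = Fin.zero ∷ vmin ks

allTups : ∀ {n} (ks : Vec ℕ n) → List (Tup ks)
allTups [] = [] L.∷ L.[]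
allTups (k ∷ ks) = concatMap (λ a → L.map (a ∷_) (allTups ks)) (allFin (suc k))

diffUpTo : ∀ {n} {ks : Vec ℕ n} → ℕ → Tup ks → Tup ks → Bool
diffUpTo zero    _       _       = false
diffUpTo (suc m) []      []      = false
diffUpTo (suc m) (a ∷ u) (b ∷ w) = not (toℕ a ≡ᵇ toℕ b) ∨ diffUpTo m u w

minLex : ∀ {n} {ks : Vec ℕ n} → List (Tup ks) → Maybe (Tup ks)
minLex L.[] = nothing
minLex (u L.∷ us) with minLex us
... | nothing = just u
... | just w  = if lexᵇ w u then just w else just u

next : ∀ {n} {ks : Vec ℕ n} → ℕ → Tup ks → Tup ks
next {n} {ks} i v with minLex (filterᵇ (λ u → lexᵇ v u ∧ diffUpTo (suc n ∸ i) v u) (allTups ks))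
... | just u  = u
... | nothing = vmin ks

-- max {0, i_1, ..., i_p} for a set X of critical variables (1-based indices)
maxCrit : ∀ {n} → Subset n → ℕ
maxCrit {n} X = L.foldr _⊔_ 0 (L.map (λ i → if lookup X i then suc (toℕ i) else 0) (allFin n))

-- Specification of eval for a formula whose truth value in M under the
-- assignment x ↦ t is φ t: eval t = (v , X) with v the truth value of φ at t
-- and φ having the same value at every t' agreeing with t on X.
EvalSpec : ∀ {n} {ks : Vec ℕ n} → (Tup ks → Bool) → (Tup ks → Bool × Subset n) → Set
EvalSpec {n} {ks} φ eval =
  ∀ t → (proj₁ (eval t) ≡ φ t)
      × (∀ t' → (∀ i → lookup (proj₂ (eval t)) i ≡ true → at t' i ≡ at t i)
              → φ t' ≡ proj₁ (eval t))

step : ∀ {n} {ks : Vec ℕ n} → (Tup ks → Bool × Subset n)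
     → Tup ks → List (Tup ks) → Tup ks × List (Tup ks)
step {n} eval t Θ with eval t
... | v , X = next (suc n ∸ maxCrit X) t , (if v then Θ else t L.∷ Θ)

-- run the repeat-until loop for at most `fuel` iterations; `just Θ` if it
-- exits (t = v_min after the update) within that many iterations
loop : ∀ {n} {ks : Vec ℕ n} → (Tup ks → Bool × Subset n)
     → ℕ → Tup ks → List (Tup ks) → Maybe (List (Tup ks))
loop eval zero t Θ = nothing
loop {ks = ks} eval (suc f) t Θ with step eval t Θ
... | t' , Θ' = if eqᵇ t' (vmin ks) then just Θ' else loop eval f t' Θ'

Hm : ∀ {n} {ks : Vec ℕ n} → (Tup ks → Bool × Subset n) → ℕ → Maybe (List (Tup ks))
Hm {ks = ks} eval fuel = loop eval fuel (vmin ks) L.[]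

Models : ∀ {n} {ks : Vec ℕ n} → (Tup ks → Bool) → Set
Models {ks = ks} φ = ∀ (t : Tup ks) → φ t ≡ true

module Submission where

-- Number the tuples of V_x by their position in the lexicographic order
-- (read as a mixed-radix numeral, this is rank).  Every iteration that does not exit moves
-- to a tuple of strictly larger rank, so the loop stops within |V_x| steps.
-- For correctness, note that the tuples jumped over by next_i agree with the
-- current tuple t on the first max{0, i_1, ..., i_p} positions, hence on all
-- critical variables of t, so φ has the same truth value on them as on t.
-- Thus, whenever Θ is still empty, φ holds on every tuple below the current
-- one, and Θ stays empty if M ⊨ ∀x φ.

open import Defs
open import Data.Nat using (ℕ)
open import Data.Bool using (Bool)
open import Data.Vec using (Vec)
open import Data.List using (List; [])
open import Data.Maybe using (just)
open import Data.Fin.Subset using (Subset)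
open import Data.Product using (Σ; _×_)
open import Function.Bundles using (_⇔_)
open import Relation.Binary.PropositionalEquality using (_≡_)

open import Data.Nat using (zero; suc; _+_; _*_; _∸_; _⊔_; _<ᵇ_; _≡ᵇ_; _≤_; _<_; z≤n; z<s; s≤s⁻¹)
open import Data.Nat.Properties
open import Data.Fin using (Fin; toℕ)
open import Data.Fin.Properties using (toℕ<n; toℕ-injective)
open import Data.Bool using (true; false; T; T?; _∧_; if_then_else_)
open import Data.Bool.Properties using (T-∧)
open import Data.Vec using ([]; _∷_; lookup)
open import Data.List as L using (allFin; filterᵇ)
open import Data.List.Properties using (foldr-preservesᵇ; foldr-preservesᵒ)
open import Data.List.Membership.Propositional using (_∈_)
open import Data.List.Membership.Propositional.Properties
  using (∉[]; ∈-allFin; ∈-map⁺; ∈-concatMap⁺; ∈-filter⁺; ∈-filter⁻)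
open import Data.List.Relation.Unary.All as All using (All)
open import Data.List.Relation.Unary.All.Properties as All using ()
open import Data.List.Relation.Unary.Any as Any using (here; there)
open import Data.List.Relation.Unary.Any.Properties as Any using ()
open import Data.Maybe using (nothing)
open import Data.Product using (_,_; proj₁; proj₂; map₂)
open import Data.Sum as Sum using (_⊎_; inj₁; inj₂)
open import Function using (_∘_)
open import Function.Bundles using (mk⇔; Equivalence)
open import Relation.Binary.PropositionalEquality using (refl; sym; trans; cong; subst)
open import Relation.Binary using (tri<; tri≈; tri>)
open import Relation.Nullary using (¬_; contradiction)
open import Relation.Nullary.Reflects using (Reflects; ofʸ; ofⁿ; fromEquivalence)

≡ᵇ-reflects-≡ : ∀ m n → Reflects (m ≡ n) (m ≡ᵇ n)
≡ᵇ-reflects-≡ m n = fromEquivalence (≡ᵇ⇒≡ m n) (≡⇒≡ᵇ m n)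

reflects-map : ∀ {A B : Set} {b} → (A → B) → (B → A) → Reflects A b → Reflects B b
reflects-map f g (ofʸ a)  = ofʸ (f a)
reflects-map f g (ofⁿ ¬a) = ofⁿ (¬a ∘ g)

reflects-sound : ∀ {A : Set} {b} → Reflects A b → T b → A
reflects-sound (ofʸ a) _ = a

reflects-complete : ∀ {A : Set} {b} → Reflects A b → A → T b
reflects-complete (ofʸ _)  _ = _
reflects-complete (ofⁿ ¬a) a = contradiction a ¬a

size : ∀ {n} → Vec ℕ n → ℕ
size [] = 1
size (k ∷ ks) = suc k * size ks

rank : ∀ {n} {ks : Vec ℕ n} → Tup ks → ℕ
rank [] = 0
rank {ks = k ∷ ks} (a ∷ u) = toℕ a * size ks + rank u

rank-∷<suc-head : ∀ {n k} {ks : Vec ℕ n} (a : Fin (suc k)) (u : Tup ks) →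
                 rank (a ∷ u) < suc (toℕ a) * size ks
rank<size : ∀ {n} {ks : Vec ℕ n} (t : Tup ks) → rank t < size ks

rank-∷<suc-head {ks = ks} a u = begin-strict
  toℕ a * size ks + rank u    <⟨ +-monoʳ-< (toℕ a * size ks) (rank<size u) ⟩
  toℕ a * size ks + size ks   ≡⟨ +-comm (toℕ a * size ks) (size ks) ⟩
  suc (toℕ a) * size ks       ∎
  where open ≤-Reasoning

rank<size [] = z<s
rank<size {ks = k ∷ ks} (a ∷ u) =
  <-≤-trans (rank-∷<suc-head a u) (*-monoˡ-≤ (size ks) (toℕ<n a))

rank-<-head : ∀ {n k} {ks : Vec ℕ n} {a b : Fin (suc k)} (u w : Tup ks) →
              toℕ a < toℕ b → rank (a ∷ u) < rank (b ∷ w)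
rank-<-head {ks = ks} {a} {b} u w a<b = begin-strict
  rank (a ∷ u)                <⟨ rank-∷<suc-head a u ⟩
  suc (toℕ a) * size ks       ≤⟨ *-monoˡ-≤ (size ks) a<b ⟩
  toℕ b * size ks             ≤⟨ m≤m+n (toℕ b * size ks) (rank w) ⟩
  rank (b ∷ w)                ∎
  where open ≤-Reasoning

rank-injective : ∀ {n} {ks : Vec ℕ n} (u w : Tup ks) → rank u ≡ rank w → u ≡ w
rank-injective [] [] _ = refl
rank-injective (a ∷ u) (b ∷ w) eq with <-cmp (toℕ a) (toℕ b)
... | tri< a<b _ _ = contradiction eq (<⇒≢ (rank-<-head u w a<b))
... | tri> _ _ b<a = contradiction (sym eq) (<⇒≢ (rank-<-head w u b<a))
... | tri≈ _ a≡b _ with refl ← toℕ-injective a≡b =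
  cong (a ∷_) (rank-injective u w (+-cancelˡ-≡ (toℕ a * _) _ _ eq))

lexᵇ-reflects-rank< : ∀ {n} {ks : Vec ℕ n} (u w : Tup ks) → Reflects (rank u < rank w) (lexᵇ u w)
lexᵇ-reflects-rank< [] [] = ofⁿ λ ()
lexᵇ-reflects-rank< (a ∷ u) (b ∷ w)
  with toℕ a <ᵇ toℕ b | <ᵇ-reflects-< (toℕ a) (toℕ b)
... | true  | ofʸ a<b = ofʸ (rank-<-head u w a<b)
... | false | ofⁿ a≮b with toℕ a ≡ᵇ toℕ b | ≡ᵇ-reflects-≡ (toℕ a) (toℕ b)
...   | false | ofⁿ a≢b =
  ofⁿ (<⇒≯ (rank-<-head w u (≤∧≢⇒< (≮⇒≥ a≮b) (a≢b ∘ sym))))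
...   | true  | ofʸ a≡b with refl ← toℕ-injective a≡b =
  reflects-map (+-monoʳ-< (toℕ a * _)) (+-cancelˡ-< (toℕ a * _) _ _) (lexᵇ-reflects-rank< u w)

eqᵇ-reflects-≡ : ∀ {n} {ks : Vec ℕ n} (u w : Tup ks) → Reflects (u ≡ w) (eqᵇ u w)
eqᵇ-reflects-≡ [] [] = ofʸ refl
eqᵇ-reflects-≡ (a ∷ u) (b ∷ w) with toℕ a ≡ᵇ toℕ b | ≡ᵇ-reflects-≡ (toℕ a) (toℕ b)
... | false | ofⁿ a≢b = ofⁿ λ { refl → a≢b refl }
... | true  | ofʸ a≡b with refl ← toℕ-injective a≡b =
  reflects-map (cong (a ∷_)) (λ { refl → refl }) (eqᵇ-reflects-≡ u w)

rank-vmin : ∀ {n} (ks : Vec ℕ n) → rank (vmin ks) ≡ 0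
rank-vmin [] = refl
rank-vmin (k ∷ ks) = rank-vmin ks

allTups-complete : ∀ {n} {ks : Vec ℕ n} (t : Tup ks) → t ∈ allTups ks
allTups-complete [] = here refl
allTups-complete {ks = k ∷ ks} (a ∷ u) =
  ∈-concatMap⁺ (λ b → L.map (b ∷_) (allTups ks))
    (Any.map (λ { refl → ∈-map⁺ (a ∷_) (allTups-complete u) }) (∈-allFin a))

minLex-nothing : ∀ {n} {ks : Vec ℕ n} (ts : List (Tup ks)) → minLex ts ≡ nothing → ts ≡ []
minLex-nothing [] _ = refl
minLex-nothing (t L.∷ ts) eq with minLex ts
minLex-nothing (t L.∷ ts) () | nothing
minLex-nothing (t L.∷ ts) _ | just m with lexᵇ m t
minLex-nothing (t L.∷ ts) () | just m | true
minLex-nothing (t L.∷ ts) () | just m | false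

minLex-just : ∀ {n} {ks : Vec ℕ n} (ts : List (Tup ks)) {u : Tup ks} → minLex ts ≡ just u →
              u ∈ ts × All (λ w → rank u ≤ rank w) ts
minLex-just (t L.∷ ts) eq with minLex ts in eqₜₛ
minLex-just (t L.∷ ts) refl | nothing rewrite minLex-nothing ts eqₜₛ =
  here refl , ≤-refl All.∷ All.[]
minLex-just (t L.∷ ts) eq | just m
  with minLex-just ts eqₜₛ | lexᵇ m t | lexᵇ-reflects-rank< m t
minLex-just (t L.∷ ts) refl | just m | m∈ts , m≤ts | true | ofʸ m<t =
  there m∈ts , <⇒≤ m<t All.∷ m≤ts
minLex-just (t L.∷ ts) refl | just m | m∈ts , m≤ts | false | ofⁿ m≮t =
  here refl , ≤-refl All.∷ All.map (≤-trans (≮⇒≥ m≮t)) m≤ts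

module _ {n} {ks : Vec ℕ n} (i : ℕ) where

  candidate : Tup ks → Tup ks → Bool
  candidate t w = lexᵇ t w ∧ diffUpTo (suc n ∸ i) t w

  candidate-∈ : ∀ {t w} → rank t < rank w → T (diffUpTo (suc n ∸ i) t w) →
                w ∈ filterᵇ (candidate t) (allTups ks)
  candidate-∈ {t} {w} t<w d = ∈-filter⁺ (T? ∘ candidate t) (allTups-complete w)
    (Equivalence.from T-∧ (reflects-complete (lexᵇ-reflects-rank< t w) t<w , d))

  candidate-above : ∀ {t w} → w ∈ filterᵇ (candidate t) (allTups ks) → rank t < rank w
  candidate-above {t} {w} w∈ = reflects-sound (lexᵇ-reflects-rank< t w)
    (proj₁ (Equivalence.to T-∧ (proj₂ (∈-filter⁻ (T? ∘ candidate t) {xs = allTups ks} w∈))))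

next-spec : ∀ {n} {ks : Vec ℕ n} (i : ℕ) (t : Tup ks) →
  (next i t ≡ vmin ks × (∀ w → rank t < rank w → ¬ T (diffUpTo (suc n ∸ i) t w)))
  ⊎ (rank t < rank (next i t)
     × (∀ w → rank t < rank w → rank w < rank (next i t) → ¬ T (diffUpTo (suc n ∸ i) t w)))
next-spec {n} {ks} i t with minLex (filterᵇ (candidate i t) (allTups ks)) in eq
... | nothing = inj₁ (refl , λ w t<w d →
  ∉[] (subst (w ∈_) (minLex-nothing _ eq) (candidate-∈ i t<w d)))
... | just u with u∈ , u≤ ← minLex-just _ eq =
  inj₂ (candidate-above i u∈ , λ w t<w w<u d → <⇒≱ w<u (All.lookup u≤ (candidate-∈ i t<w d)))

¬diffUpTo⇒at-≡ : ∀ {n} {ks : Vec ℕ n} m (t w : Tup ks) → ¬ T (diffUpTo m t w) →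
                 ∀ i → toℕ i < m → at w i ≡ at t i
¬diffUpTo⇒at-≡ (suc m) (a ∷ t) (b ∷ w) ¬d i i<m
  with toℕ a ≡ᵇ toℕ b | ≡ᵇ-reflects-≡ (toℕ a) (toℕ b)
... | false | _ = contradiction _ ¬d
... | true  | ofʸ a≡b with refl ← toℕ-injective a≡b with i
...   | Fin.zero  = refl
...   | Fin.suc j = ¬diffUpTo⇒at-≡ m t w ¬d j (s≤s⁻¹ i<m)

maxCrit≤ : ∀ {n} (X : Subset n) → maxCrit X ≤ n
maxCrit≤ {n} X = foldr-preservesᵇ {P = _≤ n} ⊔-lub z≤n (All.map⁺ (All.universal bounded (allFin n)))
  where
  bounded : ∀ i → (if lookup X i then suc (toℕ i) else 0) ≤ n
  bounded i with lookup X i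
  ... | true  = toℕ<n i
  ... | false = z≤n

critical<maxCrit : ∀ {n} (X : Subset n) {i} → lookup X i ≡ true → toℕ i < maxCrit X
critical<maxCrit {n} X {i} Xi =
  foldr-preservesᵒ {P = suc (toℕ i) ≤_} ≤-⊔ 0 _ (inj₂ (Any.map⁺ (Any.map reached (∈-allFin i))))
  where
  ≤-⊔ : ∀ x y → suc (toℕ i) ≤ x ⊎ suc (toℕ i) ≤ y → suc (toℕ i) ≤ x ⊔ y
  ≤-⊔ x y (inj₁ p) = ≤-trans p (m≤m⊔n x y)
  ≤-⊔ x y (inj₂ p) = ≤-trans p (m≤n⊔m x y)
  reached : ∀ {j} → i ≡ j → suc (toℕ i) ≤ (if lookup X j then suc (toℕ j) else 0)
  reached refl rewrite Xi = ≤-refl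

¬diffUpTo⇒critical-≡ : ∀ {n} {ks : Vec ℕ n} (X : Subset n) (t w : Tup ks) →
  ¬ T (diffUpTo (suc n ∸ (suc n ∸ maxCrit X)) t w) → ∀ i → lookup X i ≡ true → at w i ≡ at t i
¬diffUpTo⇒critical-≡ {n} X t w ¬d i Xi = ¬diffUpTo⇒at-≡ _ t w ¬d i
  (subst (toℕ i <_) (sym (m∸[m∸n]≡n (m≤n⇒m≤1+n (maxCrit≤ X)))) (critical<maxCrit X Xi))

module Correctness {n} {ks : Vec ℕ n} (φ : Tup ks → Bool) (eval : Tup ks → Bool × Subset n)
                   (spec : EvalSpec φ eval) where

  Invariant : Tup ks → List (Tup ks) → Set
  Invariant t Θ = (Θ ≡ [] → ∀ w → rank w < rank t → φ w ≡ true) × (Models φ → Θ ≡ [])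

  visit : ∀ {t Θ v} → Invariant t Θ → v ≡ φ t →
          ((if v then Θ else t L.∷ Θ) ≡ [] → ∀ w → (rank t < rank w → φ w ≡ v) → φ w ≡ true)
          × (Models φ → (if v then Θ else t L.∷ Θ) ≡ [])
  visit {t} {Θ} {true} (below , models⇒[]) v≡φt = covered , models⇒[]
    where
    covered : Θ ≡ [] → ∀ w → (rank t < rank w → φ w ≡ true) → φ w ≡ true
    covered Θ≡[] w above with <-cmp (rank w) (rank t)
    ... | tri< w<t _ _ = below Θ≡[] w w<t
    ... | tri≈ _ w≡t _ rewrite rank-injective w t w≡t = sym v≡φt
    ... | tri> _ _ t<w = above t<w
  visit {t} {v = false} _ v≡φt = (λ ()) , λ models → contradiction (trans v≡φt (models t)) λ ()

  Progress : Tup ks → Tup ks × List (Tup ks) → Set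
  Progress t (t' , Θ') = (t' ≡ vmin ks × (Θ' ≡ [] ⇔ Models φ)) ⊎ (rank t < rank t' × Invariant t' Θ')

  step-progress : ∀ t Θ → Invariant t Θ → Progress t (step eval t Θ)
  step-progress t Θ inv with eval t | spec t
  ... | v , X | v≡φt , sound with visit inv v≡φt
  ... | covered , models⇒[] = Sum.map
    (map₂ λ beyond → mk⇔ (λ Θ'≡[] w → covered Θ'≡[] w (skipped w ∘ beyond w)) models⇒[])
    (map₂ λ between →
      (λ Θ'≡[] w w<t' → covered Θ'≡[] w λ t<w → skipped w (between w t<w w<t')) , models⇒[])
    (next-spec (suc n ∸ maxCrit X) t)
    where
    skipped : ∀ w → ¬ T (diffUpTo (suc n ∸ (suc n ∸ maxCrit X)) t w) → φ w ≡ v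
    skipped w = sound w ∘ ¬diffUpTo⇒critical-≡ X t w

  loop-correct : ∀ fuel t Θ → size ks ≤ rank t + fuel → Invariant t Θ →
                 Σ (List (Tup ks)) λ Θ' → loop eval fuel t Θ ≡ just Θ' × (Θ' ≡ [] ⇔ Models φ)
  loop-correct zero t Θ enough _ =
    contradiction (subst (size ks ≤_) (+-identityʳ (rank t)) enough) (<⇒≱ (rank<size t))
  loop-correct (suc fuel) t Θ enough inv = continue (step eval t Θ) (step-progress t Θ inv)
    where
    continue : ∀ s → Progress t s → Σ (List (Tup ks)) λ Θ' →
      (if eqᵇ (proj₁ s) (vmin ks) then just (proj₂ s) else loop eval fuel (proj₁ s) (proj₂ s))
        ≡ just Θ' × (Θ' ≡ [] ⇔ Models φ)
    continue (t' , Θ') progress with eqᵇ t' (vmin ks) | eqᵇ-reflects-≡ t' (vmin ks) | progress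
    ... | true  | _        | inj₁ (_ , correct)  = Θ' , refl , correct
    ... | false | ofⁿ t'≢0 | inj₁ (t'≡0 , _)     = contradiction t'≡0 t'≢0
    ... | true  | ofʸ refl | inj₂ (t<0 , _)      = contradiction (subst (rank t <_) (rank-vmin ks) t<0) n≮0
    ... | false | _        | inj₂ (t<t' , inv') = loop-correct fuel t' Θ' enough' inv'
      where
      enough' : size ks ≤ rank t' + fuel
      enough' = ≤-trans enough (≤-trans (≤-reflexive (+-suc (rank t) fuel)) (+-monoˡ-≤ fuel t<t'))

  initial : Invariant (vmin ks) []
  initial = (λ _ w w<0 → contradiction (subst (rank w <_) (rank-vmin ks) w<0) n≮0) , λ _ → refl

theorem5 : ∀ {n} (ks : Vec ℕ n) (φ : Tup ks → Bool) (eval : Tup ks → Bool × Subset n)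
    → EvalSpec φ eval
    → Σ (List (Tup ks)) (λ Θ → Σ ℕ (λ fuel → Hm eval fuel ≡ just Θ) × (Θ ≡ [] ⇔ Models φ))
theorem5 ks φ eval spec =
  let Θ , terminates , correct = loop-correct (size ks) (vmin ks) [] enough initial
  in  Θ , (size ks , terminates) , correct
  where
  open Correctness φ eval spec
  enough : size ks ≤ rank (vmin ks) + size ks
  enough rewrite rank-vmin ks = ≤-refl
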